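{- $M(3,3)=3$.
   Context: Consider a ring with node set $V(C_n)$ of $n$ nodes. A request graph is a simple graph $R$ whose vertices are nodes of the ring. Given integers $n,C,\Delta\ge1$, an assignment of nonnegative integers $A(v)$, $v\in V(C_n)$, is feasible if for every request graph $R$ of maximum degree at most $\Delta$ there exists a partition of $E(R)$ into subgraphs $B_1,\dots,B_\Lambda$ such that $|E(B_\lambda)|\le C$ for all $\lambda$ and every vertex $v$ appears in at most $A(v)$ of the subgraphs $B_\lambda$. $A(n,C,\Delta)$ denotes the minimum of $\sum_{v}A(v)$ over all feasible assignments. $M(C,\Delta)$ is the least positive number $M$ such that $A(n,C,\Delta)\le Mn$ for every $n\ge1$.
   Formalization: The positive number M in the definition of $M(C,\Delta)$, together with every competing bound, ranges over the rationals. -}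

module Defs where

open import Data.Bool.Base using (Bool; true; false; _∧_; T)
open import Data.Nat.Base using (ℕ; _≤_)
open import Data.Fin.Base using (Fin) renaming (_<_ to _<ᶠ_)
open import Data.Fin.Properties using (_≟_; _<?_)
open import Data.List.Base using (List; allFin; filterᵇ; length; map)
open import Data.Nat.ListAction using (sum)
open import Data.Bool.ListAction using (any)
open import Data.Product.Base using (Σ; _×_; ∃-syntax)
open import Relation.Binary.PropositionalEquality using (_≡_)
open import Relation.Nullary.Decidable.Core using (⌊_⌋)

-- The nodes of the ring C_n are identified with Fin n.
-- (The ring structure plays no role in the definitions.)

record SimpleGraph (n : ℕ) : Set where
  field
    adj   : Fin n → Fin n → Bool
    sym   : ∀ u v → adj u v ≡ adj v u
    irrfl : ∀ v → adj v v ≡ false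
open SimpleGraph public

degree : ∀ {n} → SimpleGraph n → Fin n → ℕ
degree {n} R v = length (filterᵇ (adj R v) (allFin n))

MaxDegreeAtMost : ∀ {n} → SimpleGraph n → ℕ → Set
MaxDegreeAtMost R Δ = ∀ v → degree R v ≤ Δ

-- A partition of E(R) into Λ subgraphs B_0,…,B_{Λ-1}: every edge {u,v}
-- receives an index col u v ∈ Fin Λ (symmetric, so it depends only on the
-- unordered edge); B_λ is the set of edges with index λ.  Values of col on
-- non-edges are irrelevant.
record EdgePartition {n} (R : SimpleGraph n) (Λ : ℕ) : Set where
  field
    col    : Fin n → Fin n → Fin Λ
    colSym : ∀ u v → col u v ≡ col v u
open EdgePartition public

inBlock : ∀ {n Λ} {R : SimpleGraph n} → EdgePartition R Λ →
          Fin Λ → Fin n → Fin n → Bool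
inBlock {R = R} P λ′ u v = ⌊ u <? v ⌋ ∧ (adj R u v ∧ ⌊ col P u v ≟ λ′ ⌋)

blockSize : ∀ {n Λ} {R : SimpleGraph n} → EdgePartition R Λ → Fin Λ → ℕ
blockSize {n} P λ′ =
  sum (map (λ u → length (filterᵇ (inBlock P λ′ u) (allFin n))) (allFin n))

appearsIn : ∀ {n Λ} {R : SimpleGraph n} → EdgePartition R Λ →
            Fin n → Fin Λ → Bool
appearsIn {n} {R = R} P v λ′ =
  any (λ w → adj R v w ∧ ⌊ col P v w ≟ λ′ ⌋) (allFin n)

appearances : ∀ {n Λ} {R : SimpleGraph n} → EdgePartition R Λ → Fin n → ℕ
appearances {Λ = Λ} P v = length (filterᵇ (appearsIn P v) (allFin Λ))

Feasible : (n C Δ : ℕ) → (Fin n → ℕ) → Set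
Feasible n C Δ A =
  (R : SimpleGraph n) → MaxDegreeAtMost R Δ →
  Σ ℕ λ Λ → Σ (EdgePartition R Λ) λ P →
    (∀ λ′ → blockSize P λ′ ≤ C) × (∀ v → appearances P v ≤ A v)

total : ∀ {n} → (Fin n → ℕ) → ℕ
total {n} A = sum (map A (allFin n))

-- "A(n,C,Δ) ≤ x": since A(n,C,Δ) is the minimum of total A over feasible A,
-- this holds iff some feasible assignment has total at most x.
-- x is rational so that A(n,C,Δ) ≤ M·n can be expressed for rational M.
open import Data.Rational.Base as ℚ using (ℚ)
open import Data.Integer.Base using (+_)

ℕ→ℚ : ℕ → ℚ
ℕ→ℚ k = + k ℚ./ 1

A≤ : (n C Δ : ℕ) → ℚ → Set
A≤ n C Δ x = ∃[ A ] (Feasible n C Δ A × (ℕ→ℚ (total A) ℚ.≤ x))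

GoodBound : (C Δ : ℕ) → ℚ → Set
GoodBound C Δ M = ∀ n → 1 ≤ n → A≤ n C Δ (M ℚ.* ℕ→ℚ n)

IsM : (C Δ : ℕ) → ℚ → Set
IsM C Δ M = ℚ.0ℚ ℚ.< M × GoodBound C Δ M ×
            (∀ M′ → ℚ.0ℚ ℚ.< M′ → GoodBound C Δ M′ → M ℚ.≤ M′)

-- Upper bound: give every edge the colour of its smaller endpoint.  Each block
-- is then a star of at most Δ edges and a vertex v lies in at most deg v blocks,
-- so the constant assignment Δ is feasible for C = Δ.
--
-- Lower bound: a vertex lying in at most two blocks has two incident edges of
-- the same colour.  There is a cubic graph on 22 vertices, a hub joined to
-- three blobs, in which this cannot happen at every vertex when blocks have at
-- most 3 edges; this is checked blob by blob by a certified search over the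
-- possible equal pairs, and then at the hub.  So in a feasible assignment fewer
-- than 22 vertices v have A(v) ≤ 2, hence Σ A ≥ 3n − 63, and A(n,3,3) ≤ M n
-- for all n forces M ≥ 3.

module Submission where

open import Defs hiding (sym)
open import Data.Bool.Base using (Bool; true; false; T; _∧_; _∨_; if_then_else_)
open import Data.Bool.ListAction using (all)
open import Data.Bool.Properties using (T-∧; T-∨)
open import Data.Empty using (⊥; ⊥-elim)
open import Data.Fin using (#_)
import Data.Fin.Base as Fin
open Fin using (Fin; toℕ) renaming (_<_ to _<ᶠ_)
open import Data.Fin.Properties using (_≟_; _<?_; <-asym; toℕ-injective; ≤∧≢⇒<; any?; all?)
import Data.Integer.Base as ℤ
import Data.Integer.Properties as ℤ
import Data.List.Base as List
open import Data.List.Base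
  using (List; []; _∷_; _++_; map; concatMap; filter; filterᵇ; length; allFin)
open import Data.List.Properties
  using (length-map; length-++; length-removeAt′; length-tabulate; map-cong; filter-≐; ≡-dec)
open import Data.List.Membership.Propositional using (_∈_; lose; find)
open import Data.List.Membership.Propositional.Properties
  using (∈-allFin; ∈-map⁺; ∈-map⁻; ∈-filter⁺; ∈-filter⁻; ∈-concatMap⁺)
open import Data.List.Relation.Binary.Subset.Propositional using (_⊆_)
open import Data.List.Relation.Unary.All as All using (All; []; _∷_)
import Data.List.Relation.Unary.All.Properties as AllP
open import Data.List.Relation.Unary.AllPairs using ([]; _∷_)
open import Data.List.Relation.Unary.Any as Any using (Any; here; there; _─_)
import Data.List.Relation.Unary.Any.Properties as AnyP
open import Data.List.Relation.Unary.Unique.Propositional using (Unique)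
import Data.List.Relation.Unary.Unique.Propositional.Properties as Unique
open import Data.Nat.Base
  using (ℕ; zero; suc; _+_; _*_; _≤_; _<_; _≤ᵇ_; _≡ᵇ_; _<ᵇ_; z≤n; s≤s)
import Data.Nat.Coprimality as Coprime
open import Data.Nat.ListAction using (sum)
import Data.Nat.Properties as ℕ
open import Data.Nat.Tactic.RingSolver using (solve-∀)
open import Data.Product.Base using (Σ; ∃; _×_; _,_; proj₁; proj₂)
open import Data.Rational.Base using (mkℚ)
import Data.Rational.Base as ℚ
import Data.Rational.Properties as ℚ
open import Data.Rational.Unnormalised.Base using (mkℚᵘ)
import Data.Rational.Unnormalised.Base as ℚᵘ
import Data.Rational.Unnormalised.Properties as ℚᵘ
open import Data.Sum.Base using (_⊎_; inj₁; inj₂)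
open import Data.Vec.Base as Vec using (Vec; lookup; []; _∷_)
open import Data.Vec.Properties using (lookup-map; lookup∘tabulate)
open import Function.Base using (id; _∘_; _$_)
open import Function.Bundles using (Equivalence; _⇔_; mk⇔)
open import Function.Definitions using (Injective)
open import Relation.Binary.PropositionalEquality
  using (_≡_; _≢_; refl; sym; trans; cong; cong₂; subst; subst₂)
open import Relation.Nullary using (¬_; Dec; yes; no)
open import Relation.Nullary.Decidable
  using (¬?; _→-dec_; _×-dec_; _⊎-dec_; does-⇔; dec-false; isYes≗does)
open import Relation.Nullary.Decidable.Core using (⌊_⌋; T?; toWitness; fromWitness)

module _ {A : Set} where

  ∈-─ : ∀ {x y} {ys : List A} (x∈ys : x ∈ ys) → y ∈ ys → y ≢ x → y ∈ (ys ─ x∈ys)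
  ∈-─ (here refl) (here refl) y≢x = ⊥-elim (y≢x refl)
  ∈-─ (here refl) (there y∈ys) _  = y∈ys
  ∈-─ (there _)   (here refl) _   = here refl
  ∈-─ (there x∈ys) (there y∈ys) y≢x = there (∈-─ x∈ys y∈ys y≢x)

  length-≤-⊆ : ∀ {xs ys : List A} → Unique xs → xs ⊆ ys → length xs ≤ length ys
  length-≤-⊆ [] _ = z≤n
  length-≤-⊆ {x ∷ xs} {ys} (x≢xs ∷ xs!) xs⊆ys = begin
    suc (length xs)          ≤⟨ s≤s (length-≤-⊆ xs! step) ⟩
    suc (length (ys ─ x∈ys)) ≡⟨ sym (length-removeAt′ ys _) ⟩
    length ys                ∎
    where
    open ℕ.≤-Reasoning
    x∈ys = xs⊆ys (here refl)
    step : xs ⊆ (ys ─ x∈ys)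
    step y∈xs = ∈-─ x∈ys (xs⊆ys (there y∈xs)) (All.lookup x≢xs y∈xs ∘ sym)

  unique-filterᵇ : ∀ (p : A → Bool) {xs} → Unique xs → Unique (filterᵇ p xs)
  unique-filterᵇ p = Unique.filter⁺ (T? ∘ p)

  pairs : List A → List (A × A)
  pairs []       = []
  pairs (x ∷ xs) = map (x ,_) xs ++ pairs xs

  pairs-distinct⇒Unique : ∀ {B : Set} (f : A → B) xs →
    ¬ Any (λ (x , y) → f x ≡ f y) (pairs xs) → Unique (map f xs)
  pairs-distinct⇒Unique f []       _ = []
  pairs-distinct⇒Unique f (x ∷ xs) h =
    AllP.map⁺ (AllP.map⁻ (proj₁ (AllP.++⁻ (map (x ,_) xs) (AllP.¬Any⇒All¬ _ h))))
    ∷ pairs-distinct⇒Unique f xs (h ∘ AnyP.++⁺ʳ (map (x ,_) xs))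

  unique-embedding : ∀ {k} {xs : List A} → Unique xs → k ≤ length xs →
    Σ (Fin k → A) λ p → Injective _≡_ _≡_ p × (∀ i → p i ∈ xs)
  unique-embedding {zero} _ _ = (λ ()) , (λ { {()} }) , (λ ())
  unique-embedding {suc k} {x ∷ xs} (x≢xs ∷ xs!) (s≤s k≤) with unique-embedding xs! k≤
  ... | p , p-inj , p∈ = q , q-inj , q∈
    where
    q : Fin (suc k) → A
    q Fin.zero    = x
    q (Fin.suc i) = p i
    q-inj : Injective _≡_ _≡_ q
    q-inj {Fin.zero}  {Fin.zero}  _ = refl
    q-inj {Fin.zero}  {Fin.suc j} e = ⊥-elim (All.lookup x≢xs (p∈ j) e)
    q-inj {Fin.suc i} {Fin.zero}  e = ⊥-elim (All.lookup x≢xs (p∈ i) (sym e))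
    q-inj {Fin.suc i} {Fin.suc j} e = cong Fin.suc (p-inj e)
    q∈ : ∀ i → q i ∈ (x ∷ xs)
    q∈ Fin.zero    = here refl
    q∈ (Fin.suc i) = there (p∈ i)

-- Each vertex of weight > t contributes at least t + 1 to the sum.
length-≤-sum+poor : ∀ {B : Set} t (w : B → ℕ) xs →
  length xs * suc t ≤ sum (map w xs) + length (filterᵇ (λ v → w v ≤ᵇ t) xs) * suc t
length-≤-sum+poor t w [] = z≤n
length-≤-sum+poor t w (x ∷ xs) with ih ← length-≤-sum+poor t w xs | w x ≤ᵇ t in eq
... | true  = ℕ.≤-trans (ℕ.+-monoʳ-≤ (suc t) ih)
                (ℕ.≤-trans (ℕ.m≤n+m _ (w x)) (ℕ.≤-reflexive (shuffle (w x) (suc t) _ _)))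
  where
  shuffle : ∀ a b c d → a + (b + (c + d)) ≡ a + c + (b + d)
  shuffle = solve-∀
... | false = ℕ.≤-trans (ℕ.+-mono-≤ rich ih) (ℕ.≤-reflexive (sym (ℕ.+-assoc (w x) _ _)))
  where
  rich : suc t ≤ w x
  rich = ℕ.≰⇒> (λ wx≤t → subst T eq (ℕ.≤⇒≤ᵇ wx≤t))

length-concatMap : ∀ {A B : Set} (f : A → List B) xs →
  length (concatMap f xs) ≡ sum (map (length ∘ f) xs)
length-concatMap f []       = refl
length-concatMap f (x ∷ xs) =
  trans (length-++ (f x)) (cong (length (f x) +_) (length-concatMap f xs))

sum-≤-single : ∀ {n} (f : Fin n → ℕ) a {xs} → Unique xs →
  (∀ x → x ≢ a → f x ≡ 0) → sum (map f xs) ≤ f a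
sum-≤-single f a []                 _    = z≤n
sum-≤-single f a {x ∷ xs} (x≢xs ∷ xs!) rest with x ≟ a
... | no x≢a   = subst (λ k → k + sum (map f xs) ≤ f a) (sym (rest x x≢a))
                   (sum-≤-single f a xs! rest)
... | yes refl = ℕ.≤-reflexive (trans (cong (f x +_) (sum-zero xs x≢xs)) (ℕ.+-identityʳ (f x)))
  where
  sum-zero : ∀ ys → All (x ≢_) ys → sum (map f ys) ≡ 0
  sum-zero []       []           = refl
  sum-zero (y ∷ ys) (x≢y ∷ x≢ys) =
    trans (cong (_+ sum (map f ys)) (rest y (x≢y ∘ sym))) (sum-zero ys x≢ys)

module _ {n : ℕ} where

  Joins : Fin n × Fin n → Fin n → Fin n → Set
  Joins (x , y) u v = (u ≡ x × v ≡ y) ⊎ (u ≡ y × v ≡ x)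

  joins? : ∀ e u v → Dec (Joins e u v)
  joins? (x , y) u v = (u ≟ x ×-dec v ≟ y) ⊎-dec (u ≟ y ×-dec v ≟ x)

  Joins-sym : ∀ {e u v} → Joins e u v → Joins e v u
  Joins-sym (inj₁ (u≡x , v≡y)) = inj₂ (v≡y , u≡x)
  Joins-sym (inj₂ (u≡y , v≡x)) = inj₁ (v≡x , u≡y)

  Incident : Fin n → Fin n × Fin n → Set
  Incident v (x , y) = v ≡ x ⊎ v ≡ y

  incident? : ∀ v e → Dec (Incident v e)
  incident? v (x , y) = v ≟ x ⊎-dec v ≟ y

  orient : Fin n × Fin n → Fin n × Fin n
  orient (u , v) with u <? v
  ... | yes _ = u , v
  ... | no  _ = v , u

  orient-comm : ∀ u v → orient (u , v) ≡ orient (v , u)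
  orient-comm u v with u <? v | v <? u
  ... | yes u<v | yes v<u = ⊥-elim (<-asym u<v v<u)
  ... | yes _   | no  _   = refl
  ... | no  _   | yes _   = refl
  ... | no  u≮v | no  v≮u = cong₂ _,_ (sym u≡v) u≡v
    where u≡v = toℕ-injective (ℕ.≤-antisym (ℕ.≮⇒≥ v≮u) (ℕ.≮⇒≥ u≮v))

  orient-of-< : ∀ {u v} → u <ᶠ v → orient (u , v) ≡ (u , v)
  orient-of-< {u} {v} u<v with u <? v
  ... | yes _   = refl
  ... | no  u≮v = ⊥-elim (u≮v u<v)

  orient-< : ∀ {u v} → u ≢ v → proj₁ (orient (u , v)) <ᶠ proj₂ (orient (u , v))
  orient-< {u} {v} u≢v with u <? v
  ... | yes u<v = u<v
  ... | no  u≮v = ≤∧≢⇒< (ℕ.≮⇒≥ u≮v) (u≢v ∘ sym)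

  orient-joins : ∀ e → Joins e (proj₁ (orient e)) (proj₂ (orient e))
  orient-joins (u , v) with u <? v
  ... | yes _ = inj₁ (refl , refl)
  ... | no  _ = inj₂ (refl , refl)

neighbours : ∀ {n} → SimpleGraph n → Fin n → List (Fin n)
neighbours {n} R v = filterᵇ (adj R v) (allFin n)

module _ {n Λ} {R : SimpleGraph n} (P : EdgePartition R Λ) where

  blockEdges : Fin Λ → List (Fin n × Fin n)
  blockEdges λ′ = concatMap (λ u → map (u ,_) (filterᵇ (inBlock P λ′ u) (allFin n))) (allFin n)

  length-blockEdges : ∀ λ′ → length (blockEdges λ′) ≡ blockSize P λ′
  length-blockEdges λ′ =
    trans (length-concatMap _ (allFin n)) (cong sum (map-cong row (allFin n)))
    where
    row : ∀ u → length (map (u ,_) (filterᵇ (inBlock P λ′ u) (allFin n)))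
              ≡ length (filterᵇ (inBlock P λ′ u) (allFin n))
    row u = length-map (u ,_) (filterᵇ (inBlock P λ′ u) (allFin n))

  inBlock-intro : ∀ {λ′ u v} → u <ᶠ v → T (adj R u v) → col P u v ≡ λ′ → T (inBlock P λ′ u v)
  inBlock-intro {λ′} {u} {v} u<v uv col≡ =
    Equivalence.from T-∧ (fromWitness {a? = u <? v} u<v ,
                          Equivalence.from T-∧ (uv , fromWitness {a? = col P u v ≟ λ′} col≡))

  length-≤-blockSize : ∀ {λ′ es} → Unique es →
    (∀ {e} → e ∈ es → T (inBlock P λ′ (proj₁ e) (proj₂ e))) → length es ≤ blockSize P λ′
  length-≤-blockSize {λ′} es! inB = subst (_ ≤_) (length-blockEdges λ′) (length-≤-⊆ es! e∈)
    where
    e∈ : ∀ {e} → e ∈ _ → e ∈ blockEdges λ′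
    e∈ {u , v} e∈es = ∈-concatMap⁺ _ (lose (∈-allFin u)
      (∈-map⁺ (u ,_) (∈-filter⁺ (T? ∘ inBlock P λ′ u) (∈-allFin v) (inB e∈es))))

  appearsIn-col : ∀ {v w} → T (adj R v w) → T (appearsIn P v (col P v w))
  appearsIn-col {v} {w} vw =
    AnyP.any⁺ _ (lose (∈-allFin w) (Equivalence.from T-∧ (vw , fromWitness refl)))

  length-≤-appearances : ∀ {v cs} → Unique cs →
    (∀ {c} → c ∈ cs → T (appearsIn P v c)) → length cs ≤ appearances P v
  length-≤-appearances cs! app =
    length-≤-⊆ cs! (λ c∈cs → ∈-filter⁺ (T? ∘ appearsIn P _) (∈-allFin _) (app c∈cs))

  appearances-≤-degree : ∀ v → appearances P v ≤ degree R v
  appearances-≤-degree v = begin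
    appearances P v                         ≤⟨ length-≤-⊆ colours! colour∈ ⟩
    length (map (col P v) (neighbours R v)) ≡⟨ length-map (col P v) (neighbours R v) ⟩
    degree R v                              ∎
    where
    open ℕ.≤-Reasoning
    colours! = unique-filterᵇ (appearsIn P v) (Unique.allFin⁺ Λ)
    colour∈ : ∀ {λ′} → λ′ ∈ filterᵇ (appearsIn P v) (allFin Λ) → λ′ ∈ map (col P v) (neighbours R v)
    colour∈ {λ′} λ′∈
      with Any.satisfied (AnyP.any⁻ (λ w → adj R v w ∧ ⌊ col P v w ≟ λ′ ⌋) (allFin n)
                           (proj₂ (∈-filter⁻ (T? ∘ appearsIn P v) {xs = allFin Λ} λ′∈)))
    ... | w , vw∧col with Equivalence.to T-∧ vw∧col
    ... | vw , col≡ = subst (_∈ _) (toWitness {a? = col P v w ≟ λ′} col≡)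
                        (∈-map⁺ (col P v) (∈-filter⁺ (T? ∘ adj R v) (∈-allFin w) vw))

-- Upper bound

stars : ∀ {n} (R : SimpleGraph n) → EdgePartition R n
stars R = record
  { col    = λ u v → proj₁ (orient (u , v))
  ; colSym = λ u v → cong proj₁ (orient-comm u v)
  }

stars-feasible : ∀ n Δ → Feasible n Δ Δ (λ _ → Δ)
stars-feasible n Δ R R≤Δ =
  n , stars R , blockSize≤Δ , λ v → ℕ.≤-trans (appearances-≤-degree (stars R) v) (R≤Δ v)
  where
  module _ (λ′ : Fin n) where
    row : Fin n → ℕ
    row u = length (filterᵇ (inBlock (stars R) λ′ u) (allFin n))

    inBlock-stars : ∀ {u v} → T (inBlock (stars R) λ′ u v) → u ≡ λ′ × T (adj R u v)
    inBlock-stars {u} {v} inB with Equivalence.to T-∧ inB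
    ... | u<v , rest with Equivalence.to T-∧ rest
    ... | uv , col≡ =
      trans (sym (cong proj₁ (orient-of-< {u = u} {v} (toWitness {a? = u <? v} u<v))))
            (toWitness {a? = proj₁ (orient (u , v)) ≟ λ′} col≡) ,
      uv

    row-off : ∀ u → u ≢ λ′ → row u ≡ 0
    row-off u u≢λ′ = ℕ.n≤0⇒n≡0 (length-≤-⊆ {ys = []}
      (unique-filterᵇ _ (Unique.allFin⁺ n))
      (λ {v} v∈ → ⊥-elim (u≢λ′ (proj₁ (inBlock-stars {u} {v}
        (proj₂ (∈-filter⁻ (T? ∘ inBlock (stars R) λ′ u) {xs = allFin n} v∈)))))))

    row-on : row λ′ ≤ degree R λ′
    row-on = length-≤-⊆ (unique-filterᵇ _ (Unique.allFin⁺ n)) λ {v} v∈ →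
      ∈-filter⁺ (T? ∘ adj R λ′) (∈-allFin v)
        (proj₂ (inBlock-stars {λ′} {v}
          (proj₂ (∈-filter⁻ (T? ∘ inBlock (stars R) λ′ λ′) {xs = allFin n} v∈))))

    blockSize≤Δ : blockSize (stars R) λ′ ≤ Δ
    blockSize≤Δ = ℕ.≤-trans (sum-≤-single row λ′ (Unique.allFin⁺ n) row-off)
                            (ℕ.≤-trans row-on (R≤Δ λ′))

-- Refuting edge colourings by search

module _ {m : ℕ} {X : Set} where

  ClassesAtMost : ℕ → (Fin m → X) → Set
  ClassesAtMost C c =
    ∀ i xs → Unique xs → (∀ {j} → j ∈ xs → c j ≡ c i) → length xs ≤ C

  Holds : (Fin m → X) → Fin m × Fin m → Set
  Holds c (i , j) = c i ≡ c j

  -- A labelling records the colour equalities established so far.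
  Consistent : (Fin m → X) → Vec ℕ m → Set
  Consistent c L = ∀ i j → lookup L i ≡ lookup L j → c i ≡ c j

relabel : ∀ {m} → Vec ℕ m → Fin m → Fin m → ℕ → ℕ
relabel L x y ℓ = if ℓ ≡ᵇ lookup L y then lookup L x else ℓ

merge : ∀ {m} → Vec ℕ m → Fin m → Fin m → Vec ℕ m
merge L x y = Vec.map (relabel L x y) L

merge-fixes : ∀ {m} (L : Vec ℕ m) x y → lookup (merge L x y) x ≡ lookup L x
merge-fixes L x y = trans (lookup-map x (relabel L x y) L) (if-same (lookup L x ≡ᵇ lookup L y))
  where
  if-same : ∀ b → (if b then lookup L x else lookup L x) ≡ lookup L x
  if-same true  = refl
  if-same false = refl

classOf : ∀ {m} → Vec ℕ m → ℕ → List (Fin m)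
classOf {m} L ℓ = filterᵇ (λ i → lookup L i ≡ᵇ ℓ) (allFin m)

-- Each constraint is a list of alternatives, at least one of which is an
-- equality of colours; a branch dies once some class exceeds C edges.
refutes : ∀ {m} → ℕ → Vec ℕ m → List (List (Fin m × Fin m)) → Bool
refutes C L []          = false
refutes C L (alts ∷ cs) = all (λ (x , y) →
  (C <ᵇ length (classOf (merge L x y) (lookup L x))) ∨ refutes C (merge L x y) cs) alts

module _ {m : ℕ} {X : Set} (c : Fin m → X) where

  merge-witness : ∀ L x y → Consistent c L → c x ≡ c y → ∀ i →
    ∃ λ k → lookup (merge L x y) i ≡ lookup L k × c i ≡ c k
  merge-witness L x y cons cx≡cy i with lookup L i ≡ᵇ lookup L y in eq
  ... | true  = x , trans (lookup-map i (relabel L x y) L) (cong branch eq)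
                  , trans (cons i y (ℕ.≡ᵇ⇒≡ _ _ (subst T (sym eq) _))) (sym cx≡cy)
    where branch = λ b → if b then lookup L x else lookup L i
  ... | false = i , trans (lookup-map i (relabel L x y) L) (cong branch eq) , refl
    where branch = λ b → if b then lookup L x else lookup L i

  merge-consistent : ∀ L x y → Consistent c L → c x ≡ c y → Consistent c (merge L x y)
  merge-consistent L x y cons cx≡cy i j eq
    with merge-witness L x y cons cx≡cy i | merge-witness L x y cons cx≡cy j
  ... | k , i↦k , ci≡ck | k′ , j↦k′ , cj≡ck′ =
    trans ci≡ck (trans (cons k k′ (trans (sym i↦k) (trans eq j↦k′))) (sym cj≡ck′))

  classOf-merge : ∀ L x y → Consistent c L → c x ≡ c y →
    ∀ {i} → i ∈ classOf (merge L x y) (lookup L x) → c i ≡ c x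
  classOf-merge L x y cons cx≡cy {i} i∈ =
    merge-consistent L x y cons cx≡cy i x (trans (ℕ.≡ᵇ⇒≡ _ _ label) (sym (merge-fixes L x y)))
    where
    label = proj₂ (∈-filter⁻ (T? ∘ λ k → lookup (merge L x y) k ≡ᵇ lookup L x) {xs = allFin m} i∈)

  refutes-sound : ∀ {C} → ClassesAtMost C c → ∀ L cs → Consistent c L →
    All (Any (Holds c)) cs → T (refutes C L cs) → ⊥
  refutes-sound {C} bound L (alts ∷ cs) cons (holds ∷ rest) refuted
    with find holds
  ... | (x , y) , xy∈alts , cx≡cy
    with Equivalence.to T-∨ (All.lookup (AllP.all⁺ _ alts refuted) xy∈alts)
  ... | inj₁ overfull = ℕ.<⇒≱ (ℕ.<ᵇ⇒< _ _ overfull)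
          (bound x _ (unique-filterᵇ _ (Unique.allFin⁺ m)) (classOf-merge L x y cons cx≡cy))
  ... | inj₂ refuted′ =
          refutes-sound bound (merge L x y) cs (merge-consistent L x y cons cx≡cy) rest refuted′

  refutation : ∀ {C} → ClassesAtMost C c → ∀ cs → All (Any (Holds c)) cs →
    T (refutes C (Vec.tabulate toℕ) cs) → ⊥
  refutation bound cs = refutes-sound bound (Vec.tabulate toℕ) cs λ i j eq →
    cong c (toℕ-injective (trans (sym (lookup∘tabulate toℕ i)) (trans eq (lookup∘tabulate toℕ j))))

module _ {n m : ℕ} (e : Fin m → Fin n × Fin n) where

  Loopless : Set
  Loopless = ∀ i → proj₁ (e i) ≢ proj₂ (e i)

  Simple : Set
  Simple = ∀ {i j} → Joins (e j) (proj₁ (e i)) (proj₂ (e i)) → i ≡ j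

  incidentEdges : Fin n → List (Fin m)
  incidentEdges v = filter (λ i → incident? v (e i)) (allFin m)

  incidentEdges-unique : ∀ {v} → Unique (incidentEdges v)
  incidentEdges-unique = Unique.filter⁺ _ (Unique.allFin⁺ m)

other : ∀ {n} → Fin n → Fin n × Fin n → Fin n
other v (x , y) = if ⌊ v ≟ x ⌋ then y else x

module _ {n : ℕ} where

  Joins-loop : ∀ {x y v : Fin n} → Joins (x , y) v v → x ≡ y
  Joins-loop (inj₁ (v≡x , v≡y)) = trans (sym v≡x) v≡y
  Joins-loop (inj₂ (v≡y , v≡x)) = trans (sym v≡x) v≡y

  Joins-unique : ∀ {e e′ : Fin n × Fin n} {u v} → Joins e u v → Joins e′ u v →
    Joins e′ (proj₁ e) (proj₂ e)
  Joins-unique (inj₁ (refl , refl)) j′ = j′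
  Joins-unique (inj₂ (refl , refl)) j′ = Joins-sym j′

  Joins⇒Incident : ∀ {e : Fin n × Fin n} {v w} → Joins e v w → Incident v e
  Joins⇒Incident (inj₁ (v≡x , _)) = inj₁ v≡x
  Joins⇒Incident (inj₂ (v≡y , _)) = inj₂ v≡y

  Joins⇒other : ∀ {x y v w : Fin n} → Joins (x , y) v w → other v (x , y) ≡ w
  Joins⇒other {x} {y} {v} j with v ≟ x | j
  ... | yes _   | inj₁ (_ , w≡y)      = sym w≡y
  ... | yes v≡x | inj₂ (v≡y , w≡x)    = trans (sym v≡y) (trans v≡x (sym w≡x))
  ... | no  v≢x | inj₁ (v≡x , _)      = ⊥-elim (v≢x v≡x)
  ... | no  _   | inj₂ (_ , w≡x)      = sym w≡x

  Incident⇒Joins : ∀ {e : Fin n × Fin n} {v} → Incident v e → Joins e v (other v e)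
  Incident⇒Joins {x , y} {v} inc with v ≟ x | inc
  ... | yes v≡x | _        = inj₁ (v≡x , refl)
  ... | no  v≢x | inj₁ v≡x = ⊥-elim (v≢x v≡x)
  ... | no  _   | inj₂ v≡y = inj₂ (v≡y , refl)

module EdgeGraph {n m : ℕ} (e : Fin m → Fin n × Fin n) (loopless : Loopless e) where

  adjacent? : ∀ u v → Dec (∃ λ i → Joins (e i) u v)
  adjacent? u v = any? (λ i → joins? (e i) u v)

  graph : SimpleGraph n
  graph = record
    { adj   = λ u v → ⌊ adjacent? u v ⌋
    ; sym   = λ u v → trans (isYes≗does (adjacent? u v))
                        (trans (does-⇔ (mk⇔ swap swap) (adjacent? u v) (adjacent? v u))
                               (sym (isYes≗does (adjacent? v u))))
    ; irrfl = λ v → trans (isYes≗does (adjacent? v v))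
                      (dec-false (adjacent? v v) λ (i , j) → loopless i (Joins-loop j))
    }
    where
    swap : ∀ {u v} → ∃ (λ i → Joins (e i) u v) → ∃ (λ i → Joins (e i) v u)
    swap (i , j) = i , Joins-sym j

  adj-intro : ∀ {i u v} → Joins (e i) u v → T (adj graph u v)
  adj-intro {i} j = fromWitness (i , j)

  degree-≤-incidence : ∀ v → degree graph v ≤ length (incidentEdges e v)
  degree-≤-incidence v = begin
    degree graph v                                         ≤⟨ length-≤-⊆ neighbours! w∈ ⟩
    length (map (λ i → other v (e i)) (incidentEdges e v)) ≡⟨ length-map _ (incidentEdges e v) ⟩
    length (incidentEdges e v)                             ∎
    where
    open ℕ.≤-Reasoning
    neighbours! = unique-filterᵇ (adj graph v) (Unique.allFin⁺ n)
    w∈ : ∀ {w} → w ∈ neighbours graph v → w ∈ map (λ i → other v (e i)) (incidentEdges e v)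
    w∈ w∈N with toWitness (proj₂ (∈-filter⁻ (T? ∘ adj graph v) {xs = allFin n} w∈N))
    ... | i , j = subst (_∈ _) (Joins⇒other j)
                    (∈-map⁺ _ (∈-filter⁺ (λ i → incident? v (e i)) (∈-allFin i) (Joins⇒Incident j)))

  module _ {Λ} (P : EdgePartition graph Λ) where

    colour : Fin m → Fin Λ
    colour i = col P (proj₁ (e i)) (proj₂ (e i))

    col-Joins : ∀ {i u v} → Joins (e i) u v → col P u v ≡ colour i
    col-Joins (inj₁ (refl , refl)) = refl
    col-Joins (inj₂ (refl , refl)) = colSym P _ _

    incident⇒appearsIn : ∀ {v i} → Incident v (e i) → T (appearsIn P v (colour i))
    incident⇒appearsIn {v} inc =
      subst (T ∘ appearsIn P v) (col-Joins j) (appearsIn-col P (adj-intro j))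
      where j = Incident⇒Joins inc

    shared-colour : ∀ v → appearances P v < length (incidentEdges e v) →
      Any (Holds colour) (pairs (incidentEdges e v))
    shared-colour v few with Any.any? (λ (i , j) → colour i ≟ colour j) (pairs (incidentEdges e v))
    ... | yes shared  = shared
    ... | no  rainbow = ⊥-elim (ℕ.<⇒≱ few (begin
      length (incidentEdges e v)               ≡⟨ length-map colour (incidentEdges e v) ⟨
      length (map colour (incidentEdges e v))  ≤⟨ length-≤-appearances P colours! appears ⟩
      appearances P v                          ∎))
      where
      open ℕ.≤-Reasoning
      colours! = pairs-distinct⇒Unique colour (incidentEdges e v) rainbow
      appears : ∀ {λ′} → λ′ ∈ map colour (incidentEdges e v) → T (appearsIn P v λ′)
      appears λ′∈ with ∈-map⁻ colour λ′∈
      ... | i , i∈ , refl =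
        incident⇒appearsIn (proj₂ (∈-filter⁻ (λ i → incident? v (e i)) {xs = allFin m} i∈))

    classes-≤-blockSize : Simple e → ∀ {C} → (∀ λ′ → blockSize P λ′ ≤ C) →
      ClassesAtMost C colour
    classes-≤-blockSize simple {C} block≤ i xs xs! same = begin
      length xs                         ≡⟨ length-map (orient ∘ e) xs ⟨
      length (map (orient ∘ e) xs)      ≤⟨ length-≤-blockSize P (Unique.map⁺ orient-inj xs!) inB ⟩
      blockSize P (colour i)            ≤⟨ block≤ (colour i) ⟩
      C                                 ∎
      where
      open ℕ.≤-Reasoning
      orient-inj : ∀ {j k} → orient (e j) ≡ orient (e k) → j ≡ k
      orient-inj {j} {k} eq = simple (Joins-unique (orient-joins (e j))
        (subst (λ o → Joins (e k) (proj₁ o) (proj₂ o)) (sym eq) (orient-joins (e k))))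
      inB : ∀ {o} → o ∈ map (orient ∘ e) xs → T (inBlock P (colour i) (proj₁ o) (proj₂ o))
      inB o∈ with ∈-map⁻ (orient ∘ e) o∈
      ... | j , j∈xs , refl =
        inBlock-intro P (orient-< (loopless j)) (adj-intro (orient-joins (e j)))
          (trans (col-Joins (orient-joins (e j))) (same j∈xs))


module _ {k n m : ℕ} (e : Fin m → Fin k × Fin k)
         {p : Fin k → Fin n} (p-inj : Injective _≡_ _≡_ p) where

  embed : Fin m → Fin n × Fin n
  embed i = p (proj₁ (e i)) , p (proj₂ (e i))

  embed-loopless : Loopless e → Loopless embed
  embed-loopless loopless i = loopless i ∘ p-inj

  embed-simple : Simple e → Simple embed
  embed-simple simple (inj₁ (x≡ , y≡)) = simple (inj₁ (p-inj x≡ , p-inj y≡))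
  embed-simple simple (inj₂ (x≡ , y≡)) = simple (inj₂ (p-inj x≡ , p-inj y≡))

  Incident-embed⁻ : ∀ {a i} → Incident (p a) (embed i) → Incident a (e i)
  Incident-embed⁻ (inj₁ pa≡) = inj₁ (p-inj pa≡)
  Incident-embed⁻ (inj₂ pa≡) = inj₂ (p-inj pa≡)

  Incident-embed⁺ : ∀ {a i} → Incident a (e i) → Incident (p a) (embed i)
  Incident-embed⁺ (inj₁ a≡) = inj₁ (cong p a≡)
  Incident-embed⁺ (inj₂ a≡) = inj₂ (cong p a≡)

  embed-incidentEdges : ∀ a → incidentEdges embed (p a) ≡ incidentEdges e a
  embed-incidentEdges a = filter-≐ (λ i → incident? (p a) (embed i)) (λ i → incident? a (e i))
    (Incident-embed⁻ , Incident-embed⁺) (allFin m)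

  embed-incidence : ∀ {Δ} → (∀ a → length (incidentEdges e a) ≤ Δ) →
    ∀ v → length (incidentEdges embed v) ≤ Δ
  embed-incidence bound v with any? (λ a → p a ≟ v)
  ... | yes (a , refl) = subst (λ is → length is ≤ _) (sym (embed-incidentEdges a)) (bound a)
  ... | no  ∄a = ℕ.≤-trans (length-≤-⊆ {ys = []} (incidentEdges-unique embed) i∈) z≤n
    where
    i∈ : ∀ {i} → i ∈ incidentEdges embed v → i ∈ []
    i∈ i∈′ with proj₂ (∈-filter⁻ (λ i → incident? v (embed i)) {xs = allFin m} i∈′)
    ... | inj₁ v≡ = ⊥-elim (∄a (_ , sym v≡))
    ... | inj₂ v≡ = ⊥-elim (∄a (_ , sym v≡))

-- The gadget

-- Vertex 0 is a hub joined to the connectors 7, 14 and 21.  Connector 7k+7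
-- belongs to blob k on 7k+1, …, 7k+7: the complete bipartite graph between
-- {7k+1, 7k+2, 7k+3} and {7k+4, 7k+5, 7k+6} with the edge {7k+1, 7k+4}
-- replaced by the path 7k+1, 7k+7, 7k+4.
-- Opaque, so that the embedded gadget graph is never unfolded during type checking.
opaque
  gadgetEdge : Fin 33 → Fin 22 × Fin 22
  gadgetEdge = lookup $
    (# 0 , # 7) ∷ (# 0 , # 14) ∷ (# 0 , # 21) ∷
    (# 1 , # 5) ∷ (# 1 , # 6) ∷ (# 1 , # 7) ∷ (# 2 , # 4) ∷ (# 2 , # 5) ∷
    (# 2 , # 6) ∷ (# 3 , # 4) ∷ (# 3 , # 5) ∷ (# 3 , # 6) ∷ (# 4 , # 7) ∷
    (# 8 , # 12) ∷ (# 8 , # 13) ∷ (# 8 , # 14) ∷ (# 9 , # 11) ∷ (# 9 , # 12) ∷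
    (# 9 , # 13) ∷ (# 10 , # 11) ∷ (# 10 , # 12) ∷ (# 10 , # 13) ∷ (# 11 , # 14) ∷
    (# 15 , # 19) ∷ (# 15 , # 20) ∷ (# 15 , # 21) ∷ (# 16 , # 18) ∷ (# 16 , # 19) ∷
    (# 16 , # 20) ∷ (# 17 , # 18) ∷ (# 17 , # 19) ∷ (# 17 , # 20) ∷ (# 18 , # 21) ∷ []

  gadget-loopless : Loopless gadgetEdge
  gadget-loopless = toWitness {a? = all? λ i → ¬? (proj₁ (gadgetEdge i) ≟ proj₂ (gadgetEdge i))} _

  gadget-simple : Simple gadgetEdge
  gadget-simple {i} {j} = toWitness {a? = all? λ i → all? λ j →
    joins? (gadgetEdge j) (proj₁ (gadgetEdge i)) (proj₂ (gadgetEdge i)) →-dec i ≟ j} _ i j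

  gadget-cubic : ∀ a → length (incidentEdges gadgetEdge a) ≡ 3
  gadget-cubic = toWitness {a? = all? λ a → length (incidentEdges gadgetEdge a) ℕ.≟ 3} _

cherry : Fin 22 → List (Fin 33 × Fin 33)
cherry a = pairs (incidentEdges gadgetEdge a)

hub : Fin 22
hub = # 0

connector : Fin 3 → Fin 22
connector = lookup (# 7 ∷ # 14 ∷ # 21 ∷ [])

hubEdge : Fin 3 → Fin 33
hubEdge = lookup (# 0 ∷ # 1 ∷ # 2 ∷ [])

-- the edges {7k+1, 7k+7} and {7k+4, 7k+7}
spokes : Fin 3 → Fin 33 × Fin 33
spokes = lookup ((# 5 , # 12) ∷ (# 15 , # 22) ∷ (# 25 , # 32) ∷ [])

-- 7k+1, …, 7k+6, in an order that keeps the search small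
blobInterior : Fin 3 → List (Fin 22)
blobInterior = lookup $
  (# 1 ∷ # 5 ∷ # 2 ∷ # 4 ∷ # 6 ∷ # 3 ∷ []) ∷
  (# 8 ∷ # 12 ∷ # 9 ∷ # 11 ∷ # 13 ∷ # 10 ∷ []) ∷
  (# 15 ∷ # 19 ∷ # 16 ∷ # 18 ∷ # 20 ∷ # 17 ∷ []) ∷ []

blobConstraints : Fin 3 → List (List (Fin 33 × Fin 33))
blobConstraints k = (spokes k ∷ []) ∷ map cherry (blobInterior k)

hubConstraints : List (List (Fin 33 × Fin 33))
hubConstraints = cherry hub ∷
  List.tabulate λ k → (hubEdge k , proj₁ (spokes k)) ∷ (hubEdge k , proj₂ (spokes k)) ∷ []

opaque
  unfolding gadgetEdge

  connector-edges : ∀ k → incidentEdges gadgetEdge (connector k) ≡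
    hubEdge k ∷ proj₁ (spokes k) ∷ proj₂ (spokes k) ∷ []
  connector-edges = toWitness {a? = all? λ k → ≡-dec _≟_ (incidentEdges gadgetEdge (connector k))
    (hubEdge k ∷ proj₁ (spokes k) ∷ proj₂ (spokes k) ∷ [])} _

  -- Inside blob k the 10 edges form a triangle-free graph, so a block with e of
  -- them meets at least e + 1 of its vertices, and at least 4 blocks are needed:
  -- at least 14 vertex–block incidences.  With equal spokes there are at most
  -- 2 · 6 + 1 = 13.
  blob-refuted : ∀ k → T (refutes 3 (Vec.tabulate toℕ) (blobConstraints k))
  blob-refuted = toWitness {a? = all? λ k → T? (refutes 3 (Vec.tabulate toℕ) (blobConstraints k))} _

  hub-refuted : T (refutes 3 (Vec.tabulate toℕ) hubConstraints)
  hub-refuted = _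

-- At connector 7k+7 the two spokes cannot share the colour (blob k forbids it),
-- so the hub edge repeats a spoke colour; then two hub edges sharing a colour
-- would put four edges into one class.
module _ {X : Set} (c : Fin 33 → X) (classes : ClassesAtMost 3 c)
         (cherries : ∀ a → Any (Holds c) (cherry a)) where

  spoke-meets-hub : ∀ k →
    Any (Holds c) ((hubEdge k , proj₁ (spokes k)) ∷ (hubEdge k , proj₂ (spokes k)) ∷ [])
  spoke-meets-hub k with subst (Any (Holds c) ∘ pairs) (connector-edges k) (cherries (connector k))
  ... | here h≡s₁                = here h≡s₁
  ... | there (here h≡s₂)        = there (here h≡s₂)
  ... | there (there (here s₁≡s₂)) = ⊥-elim (refutation c classes (blobConstraints k)
          (here s₁≡s₂ ∷ AllP.map⁺ (All.universal cherries (blobInterior k))) (blob-refuted k))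

  gadget-uncolourable : ⊥
  gadget-uncolourable =
    refutation c classes hubConstraints (cherries hub ∷ AllP.tabulate⁺ spoke-meets-hub) hub-refuted

-- Lower bound

module EmbeddedGadget {n : ℕ} {p : Fin 22 → Fin n} (p-inj : Injective _≡_ _≡_ p) where

  open EdgeGraph (embed gadgetEdge p-inj) (embed-loopless gadgetEdge p-inj gadget-loopless)

  graph-maxDegree : MaxDegreeAtMost graph 3
  graph-maxDegree v = ℕ.≤-trans (degree-≤-incidence v)
    (embed-incidence gadgetEdge p-inj (ℕ.≤-reflexive ∘ gadget-cubic) v)

  no-poor-copy : ∀ {A} → Feasible n 3 3 A → (∀ a → A (p a) ≤ 2) → ⊥
  no-poor-copy {A} feasible poor = refute (feasible graph graph-maxDegree)
    where
    refute : (Σ ℕ λ Λ → Σ (EdgePartition graph Λ) λ P →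
               (∀ λ′ → blockSize P λ′ ≤ 3) × (∀ v → appearances P v ≤ A v)) → ⊥
    refute (Λ , P , block≤ , app≤) = gadget-uncolourable (colour P)
      (classes-≤-blockSize P (embed-simple gadgetEdge p-inj gadget-simple) block≤)
      λ a → subst (Any (Holds (colour P)) ∘ pairs) (same-edges a) (shared-colour P (p a) (begin-strict
        appearances P (p a)                                   ≤⟨ app≤ (p a) ⟩
        A (p a)                                               ≤⟨ poor a ⟩
        2                                                     <⟨ ℕ.≤-reflexive (sym (gadget-cubic a)) ⟩
        length (incidentEdges gadgetEdge a)                   ≡⟨ cong length (same-edges a) ⟨
        length (incidentEdges (embed gadgetEdge p-inj) (p a)) ∎))
      where
      open ℕ.≤-Reasoning
      same-edges = embed-incidentEdges gadgetEdge p-inj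

few-poor⇒total-≥ : ∀ {n} t k (A : Fin n → ℕ) →
  (∀ {p : Fin (suc k) → Fin n} → Injective _≡_ _≡_ p → (∀ a → A (p a) ≤ t) → ⊥) →
  n * suc t ≤ total A + k * suc t
few-poor⇒total-≥ {n} t k A no-copy with suc k ℕ.≤? length (filterᵇ (λ v → A v ≤ᵇ t) (allFin n))
... | yes many = ⊥-elim (no-copy p-inj λ a →
        ℕ.≤ᵇ⇒≤ _ _ (proj₂ (∈-filter⁻ (T? ∘ λ v → A v ≤ᵇ t) {xs = allFin n} (p∈ a))))
  where
  embedding = unique-embedding (unique-filterᵇ (λ v → A v ≤ᵇ t) (Unique.allFin⁺ n)) many
  p-inj = proj₁ (proj₂ embedding)
  p∈ = proj₂ (proj₂ embedding)
... | no  few = begin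
  n * suc t                             ≡⟨ cong (_* suc t) (length-tabulate {n = n} id) ⟨
  length (allFin n) * suc t             ≤⟨ length-≤-sum+poor t A (allFin n) ⟩
  total A + length poor * suc t         ≤⟨ ℕ.+-monoʳ-≤ (total A) (ℕ.*-monoˡ-≤ (suc t) poor≤k) ⟩
  total A + k * suc t                   ∎
  where
  open ℕ.≤-Reasoning
  poor = filterᵇ (λ v → A v ≤ᵇ t) (allFin n)
  poor≤k = ℕ.≤-pred (ℕ.≰⇒> few)

feasible⇒total-≥ : ∀ {n} {A : Fin n → ℕ} → Feasible n 3 3 A → n * 3 ≤ total A + 63
feasible⇒total-≥ {A = A} feasible =
  few-poor⇒total-≥ 2 21 A (λ p-inj → EmbeddedGadget.no-poor-copy p-inj feasible)

ℕ→ℚ≡mkℚ : ∀ k → ℕ→ℚ k ≡ mkℚ (ℤ.+ k) 0 (Coprime.sym (Coprime.1-coprimeTo k))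
ℕ→ℚ≡mkℚ k = ℚ.normalize-coprime _

ℚᵘ-≤-*⇔ : ∀ a d t n →
  (mkℚᵘ (ℤ.+ t) 0 ℚᵘ.≤ mkℚᵘ (ℤ.+ a) d ℚᵘ.* mkℚᵘ (ℤ.+ n) 0) ⇔ (t * suc d ≤ a * n)
ℚᵘ-≤-*⇔ a d t n = mk⇔
  (λ { (ℚᵘ.*≤* t≤an) → ℤ.drop‿+≤+ (subst₂ ℤ._≤_ lhs rhs t≤an) })
  (λ t≤an → ℚᵘ.*≤* (subst₂ ℤ._≤_ (sym lhs) (sym rhs) (ℤ.+≤+ t≤an)))
  where
  lhs : ℤ.+ t ℤ.* ℚᵘ.↧ (mkℚᵘ (ℤ.+ a) d ℚᵘ.* mkℚᵘ (ℤ.+ n) 0) ≡ ℤ.+ (t * suc d)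
  lhs = trans (sym (ℤ.pos-* t _)) (cong (λ k → ℤ.+ (t * k)) (ℕ.*-identityʳ (suc d)))
  rhs : ℚᵘ.↥ (mkℚᵘ (ℤ.+ a) d ℚᵘ.* mkℚᵘ (ℤ.+ n) 0) ℤ.* ℤ.+ 1 ≡ ℤ.+ (a * n)
  rhs = trans (ℤ.*-identityʳ _) (sym (ℤ.pos-* a n))

-- mkℚ (+ a) d c is the fraction a / (d + 1).
ℕ→ℚ-≤-*⇔ : ∀ a d .{c : Coprime.Coprime a (suc d)} t n →
  (ℕ→ℚ t ℚ.≤ mkℚ (ℤ.+ a) d c ℚ.* ℕ→ℚ n) ⇔ (t * suc d ≤ a * n)
ℕ→ℚ-≤-*⇔ a d {c} t n = mk⇔
  (λ t≤Mn → Equivalence.to (ℚᵘ-≤-*⇔ a d t n)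
    (subst₂ ≤M* (toℚᵘ-ℕ→ℚ t) (toℚᵘ-ℕ→ℚ n)
      (ℚᵘ.≤-respʳ-≃ (ℚ.toℚᵘ-homo-* M (ℕ→ℚ n)) (ℚ.toℚᵘ-mono-≤ t≤Mn))))
  (λ t≤an → ℚ.toℚᵘ-cancel-≤ (ℚᵘ.≤-respʳ-≃ (ℚᵘ.≃-sym (ℚ.toℚᵘ-homo-* M (ℕ→ℚ n)))
    (subst₂ ≤M* (sym (toℚᵘ-ℕ→ℚ t)) (sym (toℚᵘ-ℕ→ℚ n))
      (Equivalence.from (ℚᵘ-≤-*⇔ a d t n) t≤an))))
  where
  M = mkℚ (ℤ.+ a) d c
  ≤M* = λ x y → x ℚᵘ.≤ ℚ.toℚᵘ M ℚᵘ.* y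
  toℚᵘ-ℕ→ℚ : ∀ k → ℚ.toℚᵘ (ℕ→ℚ k) ≡ mkℚᵘ (ℤ.+ k) 0
  toℚᵘ-ℕ→ℚ k = cong ℚ.toℚᵘ (ℕ→ℚ≡mkℚ k)

ℕ→ℚ-pos : ∀ k → ℚ.0ℚ ℚ.< ℕ→ℚ (suc k)
ℕ→ℚ-pos k = subst (ℚ.0ℚ ℚ.<_) (sym (ℕ→ℚ≡mkℚ (suc k))) (ℚ.*<* (ℤ.+<+ (s≤s z≤n)))

total-const : ∀ {n} k → total {n} (λ _ → k) ≡ n * k
total-const {n} k = trans (go (allFin n)) (cong (_* k) (length-tabulate {n = n} id))
  where
  go : ∀ (xs : List (Fin n)) → sum (map (λ _ → k) xs) ≡ length xs * k
  go []       = refl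
  go (x ∷ xs) = cong (k +_) (go xs)

stars-good : ∀ Δ → GoodBound Δ Δ (ℕ→ℚ Δ)
stars-good Δ n _ = (λ _ → Δ) , stars-feasible n Δ ,
  subst (λ M → ℕ→ℚ (total {n} (λ _ → Δ)) ℚ.≤ M ℚ.* ℕ→ℚ n) (sym (ℕ→ℚ≡mkℚ Δ))
    (Equivalence.from (ℕ→ℚ-≤-*⇔ Δ 0 (total {n} (λ _ → Δ)) n)
      (ℕ.≤-reflexive (trans (ℕ.*-identityʳ _) (trans (total-const {n} Δ) (ℕ.*-comm n Δ)))))

-- Take n = (s + 1)(d + 1) for M = a / (d + 1).
total-≥⇒good-bound-≥ : ∀ {C Δ} r s →
  (∀ {n} {A : Fin n → ℕ} → Feasible n C Δ A → n * r ≤ total A + s) →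
  ∀ M → ℚ.0ℚ ℚ.< M → GoodBound C Δ M → ℕ→ℚ r ℚ.≤ M
total-≥⇒good-bound-≥ r s total≥ (mkℚ ℤ.-[1+ _ ] _ _) (ℚ.*<* ()) _
total-≥⇒good-bound-≥ {C} {Δ} r s total≥ M@(mkℚ (ℤ.+ a) d c) _ good =
  witness⇒r≤M (good (suc s * suc d) (s≤s z≤n))
  where
  open ℕ.≤-Reasoning
  witness⇒r≤M : A≤ (suc s * suc d) C Δ (M ℚ.* ℕ→ℚ (suc s * suc d)) → ℕ→ℚ r ℚ.≤ M
  witness⇒r≤M (A , feasible , total≤) =
    subst (ℕ→ℚ r ℚ.≤_) (ℚ.*-identityʳ M) (Equivalence.from (ℕ→ℚ-≤-*⇔ a d {c} r 1)
      (subst (r * suc d ≤_) (sym (ℕ.*-identityʳ a)) (ℕ.≤-pred r[d+1]<a+1)))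
    where
    total≤a[s+1] : total A ≤ a * suc s
    total≤a[s+1] = ℕ.*-cancelʳ-≤ (total A) (a * suc s) (suc d)
      (subst (total A * suc d ≤_) (sym (ℕ.*-assoc a (suc s) (suc d)))
        (Equivalence.to (ℕ→ℚ-≤-*⇔ a d {c} (total A) (suc s * suc d)) total≤))
    r[d+1]<a+1 : r * suc d < suc a
    r[d+1]<a+1 = ℕ.*-cancelʳ-< (suc s) (r * suc d) (suc a) (begin-strict
      r * suc d * suc s     ≡⟨ regroup r (suc d) (suc s) ⟩
      suc s * suc d * r     ≤⟨ total≥ feasible ⟩
      total A + s           ≤⟨ ℕ.+-monoˡ-≤ s total≤a[s+1] ⟩
      a * suc s + s         <⟨ ℕ.+-monoʳ-< (a * suc s) (ℕ.n<1+n s) ⟩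
      a * suc s + suc s     ≡⟨ ℕ.+-comm (a * suc s) (suc s) ⟩
      suc a * suc s         ∎)
      where
      regroup : ∀ x y z → x * y * z ≡ z * y * x
      regroup = solve-∀

proposition4 : IsM 3 3 (ℕ→ℚ 3)
proposition4 = ℕ→ℚ-pos 2 , stars-good 3 , total-≥⇒good-bound-≥ 3 63 feasible⇒total-≥
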